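{- There exists a closed class of graphs $\Im$ such that every elemental basis of $\Im$ is infinite, i.e. $|B_e| = \infty$.
   Context: All graphs are finite and may contain loops and multiple edges; graphs are considered up to isomorphism. $O_0$ denotes the null graph (no vertices). Gluing operation: given disjoint graphs $G_1, G_2$ and subgraphs $G_1' \subseteq G_1$, $G_2' \subseteq G_2$ that are isomorphic (possibly $O_0$), the graph $(G_1 \circ G_2)\tilde G$ is obtained by identifying $G_1'$ with $G_2'$ via some isomorphism; $\tilde G \cong G_1' \cong G_2'$ is the gluing subgraph. The choice of $G_1', G_2'$ and of the identifying isomorphism is free, so a gluing of $G_1,G_2$ on $\tilde G$ may yield several different graphs. For a set of graphs $\Im$, a graph $G$ is a superposition of graphs from $\Im$ if $G \in \Im$ or $G$ can be obtained by successively applying gluing operations to graphs from $\Im$ and/or to graphs previously obtained in this way. $[\Im]$ denotes the set of all superpositions of graphs from $\Im$; $\Im$ is a closed class if $[\Im] = \Im$. A subset $\Im' \subseteq \Im$ is a complete system of graphs of the closed class $\Im$ if $[\Im'] = \Im$. An elemental basis $B_e$ of a closed class $\Im$ is a complete system of graphs of $\Im$ that is minimal with respect to inclusion. -}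

module Defs where

open import Level using (Level; suc; _⊔_) renaming (zero to 0ℓ)
open import Data.Nat using (ℕ; zero; _+_; _≤_)
import Data.Nat as N
open import Data.Fin using (Fin)
import Data.Fin as F
open import Data.Product using (Σ; ∃; _×_; _,_)
open import Data.Sum using (_⊎_)
open import Data.List using (List)
open import Data.List.Relation.Unary.Any using (Any)
open import Relation.Binary.PropositionalEquality using (_≡_)
open import Relation.Nullary using (¬_; yes; no)
open import Function.Bundles using (_↔_; Inverse)
open import Function.Definitions using (Injective)

-- A finite undirected multigraph with loops on the vertex set Fin n:
-- mult i j = number of edges between i and j (mult i i = number of loops at i).
record Graph : Set where
  constructor graph
  field
    n    : ℕ
    mult : Fin n → Fin n → ℕ
    sym  : ∀ i j → mult i j ≡ mult j i
open Graph public

O₀ : Graph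
O₀ = graph 0 (λ ()) (λ ())

_≅_ : Graph → Graph → Set
G ≅ H = Σ (Fin (n G) ↔ Fin (n H)) λ σ →
          ∀ a b → mult H (Inverse.to σ a) (Inverse.to σ b) ≡ mult G a b

sumFin : (k : ℕ) → (Fin k → ℕ) → ℕ
sumFin zero    f = 0
sumFin (N.suc k) f = f F.zero + sumFin k (λ i → f (F.suc i))

δ : ∀ {m} → Fin m → Fin m → ℕ
δ a b with a F.≟ b
... | yes _ = 1
... | no  _ = 0

-- Push forward of an edge-multiplicity function along a vertex map f
-- (for injective f: the copy of the edges on the image of f).
push : ∀ {k m} → (Fin k → Fin m) → (Fin k → Fin k → ℕ) → Fin m → Fin m → ℕ
push {k} f μ u v = sumFin k λ a → sumFin k λ b → δ (f a) u N.* (δ (f b) v N.* μ a b)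

-- IsGluing G₁ G₂ G : G is (isomorphic to) a graph (G₁ ∘ G₂)G̃ obtained by
-- identifying a subgraph of G₁ with an isomorphic subgraph of G₂.
-- Concretely: G₁ and G₂ embed into G via injective vertex maps f₁, f₂ whose
-- images cover V(G); the common image is the vertex set of the gluing
-- subgraph G̃, whose edges are given by the (symmetric) multiplicity h,
-- which must be a sub-multigraph of both copies; every edge of G comes from
-- G₁ or G₂, the h edges of G̃ being counted once.
record IsGluing (G₁ G₂ G : Graph) : Set where
  field
    f₁     : Fin (n G₁) → Fin (n G)
    f₂     : Fin (n G₂) → Fin (n G)
    inj₁   : Injective _≡_ _≡_ f₁
    inj₂   : Injective _≡_ _≡_ f₂
    cover  : ∀ v → (∃ λ a → f₁ a ≡ v) ⊎ (∃ λ b → f₂ b ≡ v)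
    h      : Fin (n G) → Fin (n G) → ℕ
    h-sym  : ∀ u v → h u v ≡ h v u
    h≤₁    : ∀ u v → h u v ≤ push f₁ (mult G₁) u v
    h≤₂    : ∀ u v → h u v ≤ push f₂ (mult G₂) u v
    edges  : ∀ u v → mult G u v + h u v ≡ push f₁ (mult G₁) u v + push f₂ (mult G₂) u v

-- A class (set) of graphs: a predicate closed under isomorphism
-- (graphs are considered up to isomorphism).
record GraphClass : Set₁ where
  field
    _∈_    : Graph → Set
    ∈-iso  : ∀ {G H} → G ≅ H → _∈_ G → _∈_ H
open GraphClass public

data Sup (𝔍 : GraphClass) : Graph → Set where
  base : ∀ {G} → _∈_ 𝔍 G → Sup 𝔍 G
  glue : ∀ {G₁ G₂ G} → Sup 𝔍 G₁ → Sup 𝔍 G₂ → IsGluing G₁ G₂ G → Sup 𝔍 G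

_⊆_ : GraphClass → GraphClass → Set
A ⊆ B = ∀ G → _∈_ A G → _∈_ B G

-- 𝔍 is closed: [𝔍] = 𝔍 (𝔍 ⊆ [𝔍] holds always via base).
Closed : GraphClass → Set
Closed 𝔍 = ∀ G → Sup 𝔍 G → _∈_ 𝔍 G

CompleteSystem : GraphClass → GraphClass → Set
CompleteSystem 𝔍 𝔍' = 𝔍' ⊆ 𝔍 × (∀ G → Sup 𝔍' G → _∈_ 𝔍 G) × (∀ G → _∈_ 𝔍 G → Sup 𝔍' G)

ElementalBasis : GraphClass → GraphClass → Set₁
ElementalBasis 𝔍 B = CompleteSystem 𝔍 B × (∀ B' → B' ⊆ B → CompleteSystem 𝔍 B' → B ⊆ B')

-- A class is finite if it has finitely many isomorphism types.
FiniteClass : GraphClass → Set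
FiniteClass B = Σ (List Graph) λ L → ∀ G → _∈_ B G → Any (G ≅_) L

Infinite : GraphClass → Set
Infinite B = ¬ FiniteClass B

-- Call a vertex supported if it carries a loop and another neighbour, or has two
-- distinct neighbours other than itself, and let 𝔖 be the class of graphs all of whose
-- vertices are supported.  The two pieces of a gluing embed into it as sub-multigraphs
-- and jointly cover it, and supportedness is inherited along such embeddings, so 𝔖 is
-- closed.  The path with a loop at each end lies in 𝔖 and is tight: a nonempty supported
-- graph embedded in it is forced, step by step, to cover it.  Writing such a path as a
-- superposition of graphs of a complete system B, the piece containing a given vertex is
-- supported, hence covers the path and is again tight; descending, B contains a graph with
-- as many vertices as the path.  As the paths are arbitrarily long, no finite B is complete.
module Submission where

open import Defs hiding (sym)
open import Data.Product using (Σ; _×_; _,_; proj₁; proj₂; ∃)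
open import Data.Sum using (_⊎_; inj₁; inj₂; [_,_]′)
open import Data.Nat using (ℕ; zero; suc; _+_; _*_; _≤_; _<_; z≤n; s≤s; _⊔_; _≟_)
open import Data.Nat.Properties
open import Data.Fin using (Fin; toℕ; fromℕ<)
import Data.Fin as F
open import Data.Fin.Properties using (toℕ-injective; toℕ-fromℕ<; toℕ<n; cantor-schröder-bernstein)
import Data.Fin.Properties as Finₚ
open import Data.List using (List; _∷_; foldr)
open import Data.List.Relation.Unary.Any using (Any; here; there)
open import Data.Empty using (⊥-elim)
open import Relation.Nullary using (¬_; Dec; yes; no; _×-dec_; _⊎-dec_)
open import Relation.Binary.PropositionalEquality
open import Function.Bundles using (Inverse; Injection)
open import Function.Base using (_∘_)
open import Function.Definitions using (Injective)
open import Function.Properties.Inverse using (↔⇒↣; ↔-sym)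

δ-refl : ∀ {m} (a : Fin m) → δ a a ≡ 1
δ-refl a with a F.≟ a
... | yes _ = refl
... | no a≢a = ⊥-elim (a≢a refl)

δ-≢ : ∀ {m} {a b : Fin m} → ¬ a ≡ b → δ a b ≡ 0
δ-≢ {a = a} {b} a≢b with a F.≟ b
... | yes a≡b = ⊥-elim (a≢b a≡b)
... | no _ = refl

δ-injective : ∀ {k m} {f : Fin k → Fin m} → Injective _≡_ _≡_ f → ∀ x y → δ (f x) (f y) ≡ δ x y
δ-injective {f = f} f-inj x y with f x F.≟ f y | x F.≟ y
... | yes _  | yes _  = refl
... | no _   | no _   = refl
... | yes fx≡fy | no x≢y = ⊥-elim (x≢y (f-inj fx≡fy))
... | no fx≢fy  | yes x≡y = ⊥-elim (fx≢fy (cong f x≡y))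

sumFin-cong : ∀ k {f g : Fin k → ℕ} → (∀ i → f i ≡ g i) → sumFin k f ≡ sumFin k g
sumFin-cong zero    f≗g = refl
sumFin-cong (suc k) f≗g = cong₂ _+_ (f≗g F.zero) (sumFin-cong k (λ i → f≗g (F.suc i)))


sumFin-*ˡ : ∀ k c (g : Fin k → ℕ) → sumFin k (λ i → c * g i) ≡ c * sumFin k g
sumFin-*ˡ zero    c g = sym (*-zeroʳ c)
sumFin-*ˡ (suc k) c g = trans (cong (c * g F.zero +_) (sumFin-*ˡ k c (λ i → g (F.suc i))))
                              (sym (*-distribˡ-+ c (g F.zero) _))

sumFin-δ : ∀ k (a : Fin k) (g : Fin k → ℕ) → sumFin k (λ i → δ i a * g i) ≡ g a
sumFin-δ (suc k) F.zero g = begin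
  δ {suc k} F.zero F.zero * g F.zero + sumFin k (λ i → δ (F.suc i) F.zero * g (F.suc i))
    ≡⟨ cong₂ _+_ (cong (_* g F.zero) (δ-refl {suc k} F.zero))
                 (trans (sumFin-cong k (λ i → cong (_* g (F.suc i)) (δ-≢ {a = F.suc i} {F.zero} λ ())))
                        (sumFin-*ˡ k 0 (λ i → g (F.suc i)))) ⟩
  g F.zero + 0 + 0
    ≡⟨ trans (+-identityʳ _) (+-identityʳ _) ⟩
  g F.zero ∎
  where open ≡-Reasoning
sumFin-δ (suc k) (F.suc a) g = begin
  δ F.zero (F.suc a) * g F.zero + sumFin k (λ i → δ (F.suc i) (F.suc a) * g (F.suc i))
    ≡⟨ cong₂ _+_ (cong (_* g F.zero) (δ-≢ {a = F.zero} {F.suc a} λ ()))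
                 (sumFin-cong k (λ i → cong (_* g (F.suc i)) (δ-injective Finₚ.suc-injective i a))) ⟩
  sumFin k (λ i → δ i a * g (F.suc i))
    ≡⟨ sumFin-δ k a (λ i → g (F.suc i)) ⟩
  g (F.suc a) ∎
  where open ≡-Reasoning

push-image : ∀ {k m} {f : Fin k → Fin m} → Injective _≡_ _≡_ f → (μ : Fin k → Fin k → ℕ) →
             ∀ a b → push f μ (f a) (f b) ≡ μ a b
push-image {k} {f = f} f-inj μ a b = begin
  sumFin k (λ a′ → sumFin k λ b′ → δ (f a′) (f a) * (δ (f b′) (f b) * μ a′ b′))
    ≡⟨ sumFin-cong k (λ a′ → sumFin-cong k λ b′ →
         cong₂ (λ x y → x * (y * μ a′ b′)) (δ-injective f-inj a′ a) (δ-injective f-inj b′ b)) ⟩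
  sumFin k (λ a′ → sumFin k λ b′ → δ a′ a * (δ b′ b * μ a′ b′))
    ≡⟨ sumFin-cong k (λ a′ → trans (sumFin-*ˡ k (δ a′ a) _) (cong (δ a′ a *_) (sumFin-δ k b (μ a′)))) ⟩
  sumFin k (λ a′ → δ a′ a * μ a′ b)
    ≡⟨ sumFin-δ k a (λ a′ → μ a′ b) ⟩
  μ a b ∎
  where open ≡-Reasoning

record _↪_ (Y X : Graph) : Set where
  field
    vmap      : Fin (n Y) → Fin (n X)
    injective : Injective _≡_ _≡_ vmap
    mult-≤    : ∀ a b → mult Y a b ≤ mult X (vmap a) (vmap b)
open _↪_

↪-trans : ∀ {Z Y X} → Z ↪ Y → Y ↪ X → Z ↪ X
↪-trans e e′ = record
  { vmap      = λ a → vmap e′ (vmap e a)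
  ; injective = λ eq → injective e (injective e′ eq)
  ; mult-≤    = λ a b → ≤-trans (mult-≤ e a b) (mult-≤ e′ (vmap e a) (vmap e b))
  }

≅⇒↪ : ∀ {G H} → G ≅ H → G ↪ H
≅⇒↪ (σ , σ-mult) = record
  { vmap      = Inverse.to σ
  ; injective = Injection.injective (↔⇒↣ σ)
  ; mult-≤    = λ a b → ≤-reflexive (sym (σ-mult a b))
  }

≅⇒n≡ : ∀ {G H} → G ≅ H → n G ≡ n H
≅⇒n≡ (σ , _) = cantor-schröder-bernstein (Injection.injective (↔⇒↣ σ))
                                         (Injection.injective (↔⇒↣ (↔-sym σ)))

m+h≡p+q∧h≤q⇒p≤m : ∀ {m h p q} → m + h ≡ p + q → h ≤ q → p ≤ m
m+h≡p+q∧h≤q⇒p≤m {m} {h} {p} eq h≤q =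
  +-cancelʳ-≤ h p m (≤-trans (+-monoʳ-≤ p h≤q) (≤-reflexive (sym eq)))

module _ {G₁ G₂ G : Graph} (g : IsGluing G₁ G₂ G) where
  open IsGluing g using (f₁; f₂; h≤₁; h≤₂; edges) renaming (inj₁ to f₁-injective; inj₂ to f₂-injective)

  gluing-↪ˡ : G₁ ↪ G
  gluing-↪ˡ = record
    { vmap      = f₁
    ; injective = f₁-injective
    ; mult-≤    = λ a b → subst (_≤ mult G (f₁ a) (f₁ b)) (push-image f₁-injective (mult G₁) a b)
                            (m+h≡p+q∧h≤q⇒p≤m (edges (f₁ a) (f₁ b)) (h≤₂ (f₁ a) (f₁ b)))
    }

  gluing-↪ʳ : G₂ ↪ G
  gluing-↪ʳ = record
    { vmap      = f₂
    ; injective = f₂-injective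
    ; mult-≤    = λ a b → subst (_≤ mult G (f₂ a) (f₂ b)) (push-image f₂-injective (mult G₂) a b)
                            (m+h≡p+q∧h≤q⇒p≤m (trans (edges (f₂ a) (f₂ b)) (+-comm (push f₁ (mult G₁) (f₂ a) (f₂ b)) _))
                                              (h≤₁ (f₂ a) (f₂ b)))
    }

Supported : (X : Graph) → Fin (n X) → Set
Supported X a = (1 ≤ mult X a a × ∃ λ b → ¬ b ≡ a × 1 ≤ mult X a b)
              ⊎ (∃ λ b → ∃ λ c → ¬ b ≡ a × ¬ c ≡ a × ¬ b ≡ c × 1 ≤ mult X a b × 1 ≤ mult X a c)

AllSupported : Graph → Set
AllSupported X = ∀ a → Supported X a

Supported-↪ : ∀ {Y X} (e : Y ↪ X) {a} → Supported Y a → Supported X (vmap e a)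
Supported-↪ e {a} (inj₁ (loop , b , b≢a , ab)) =
  inj₁ (≤-trans loop (mult-≤ e a a) , vmap e b , b≢a ∘ injective e , ≤-trans ab (mult-≤ e a b))
Supported-↪ e {a} (inj₂ (b , c , b≢a , c≢a , b≢c , ab , ac)) =
  inj₂ (vmap e b , vmap e c , b≢a ∘ injective e , c≢a ∘ injective e , b≢c ∘ injective e ,
        ≤-trans ab (mult-≤ e a b) , ≤-trans ac (mult-≤ e a c))

AllSupported-≅ : ∀ {G H} → G ≅ H → AllSupported G → AllSupported H
AllSupported-≅ {G} {H} G≅H@(σ , _) G-supported v =
  subst (Supported H) (Inverse.strictlyInverseˡ σ v)
        (Supported-↪ {G} {H} (≅⇒↪ {G} {H} G≅H) (G-supported (Inverse.from σ v)))

𝔖 : GraphClass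
𝔖 = record { _∈_ = AllSupported ; ∈-iso = λ {G} {H} → AllSupported-≅ {G} {H} }

𝔖-closed : Closed 𝔖
𝔖-closed G (base G-supported) = G-supported
𝔖-closed G (glue {G₁} {G₂} s₁ s₂ g) v with IsGluing.cover g v
... | inj₁ (a , refl) = Supported-↪ (gluing-↪ˡ g) (𝔖-closed G₁ s₁ a)
... | inj₂ (b , refl) = Supported-↪ (gluing-↪ʳ g) (𝔖-closed G₂ s₂ b)

Onto : ∀ {k m} → (Fin k → Fin m) → Set
Onto f = ∀ v → ∃ λ a → f a ≡ v

injective∧onto⇒≡ : ∀ {k m} {f : Fin k → Fin m} → Injective _≡_ _≡_ f → Onto f → k ≡ m
injective∧onto⇒≡ {f = f} f-injective f-onto =
  cantor-schröder-bernstein f-injective section-injective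
  where
    section-injective : Injective _≡_ _≡_ (λ v → proj₁ (f-onto v))
    section-injective {v} {w} eq = trans (sym (proj₂ (f-onto v)))
                                         (trans (cong f eq) (proj₂ (f-onto w)))

Tight : Graph → Set
Tight X = ∀ {Y} → AllSupported Y → (e : Y ↪ X) → Fin (n Y) → Onto (vmap e)

Tight-↪ : ∀ {G X} → Tight X → G ↪ X → Tight G
Tight-↪ X-tight e Y-supported e′ y w
  with X-tight Y-supported (↪-trans e′ e) y (vmap e w)
... | a , eq = a , injective e eq

Sup-Tight⇒member : ∀ {B} → (∀ G → Sup B G → AllSupported G) →
                   ∀ {X} → Sup B X → Tight X → Fin (n X) → ∃ λ Y → _∈_ B Y × n Y ≡ n X
Sup-Tight⇒member sound (base Y∈B) _ _ = _ , Y∈B , refl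
Sup-Tight⇒member {B} sound {X} (glue s₁ s₂ g) X-tight v =
  [ (λ (a , _) → component (gluing-↪ˡ g) s₁ a) , (λ (b , _) → component (gluing-↪ʳ g) s₂ b) ]′
    (IsGluing.cover g v)
  where
    component : ∀ {G} → G ↪ X → Sup B G → Fin (n G) → ∃ λ Y → _∈_ B Y × n Y ≡ n X
    component e s a with Sup-Tight⇒member sound s (Tight-↪ X-tight e) a
    ... | Y , Y∈B , nY≡nG =
      Y , Y∈B , trans nY≡nG (injective∧onto⇒≡ (injective e) (X-tight (sound _ s) e a))

PathEdge : ℕ → ℕ → ℕ → Set
PathEdge N x y = y ≡ suc x ⊎ x ≡ suc y ⊎ (x ≡ y × (x ≡ 0 ⊎ suc x ≡ N))

pathEdge? : ∀ N x y → Dec (PathEdge N x y)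
pathEdge? N x y = (y ≟ suc x) ⊎-dec (x ≟ suc y) ⊎-dec ((x ≟ y) ×-dec ((x ≟ 0) ⊎-dec (suc x ≟ N)))

PathEdge-sym : ∀ {N x y} → PathEdge N x y → PathEdge N y x
PathEdge-sym (inj₁ y≡1+x)             = inj₂ (inj₁ y≡1+x)
PathEdge-sym (inj₂ (inj₁ x≡1+y))      = inj₁ x≡1+y
PathEdge-sym (inj₂ (inj₂ (refl , end))) = inj₂ (inj₂ (refl , end))

indicator : ∀ {P : Set} → Dec P → ℕ
indicator (yes _) = 1
indicator (no _)  = 0

indicator-cong : ∀ {P Q : Set} → (P → Q) → (Q → P) → (p : Dec P) (q : Dec Q) → indicator p ≡ indicator q
indicator-cong _   _   (yes _) (yes _) = refl
indicator-cong _   _   (no _)  (no _)  = refl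
indicator-cong P⇒Q _   (yes p) (no ¬q) = ⊥-elim (¬q (P⇒Q p))
indicator-cong _   Q⇒P (no ¬p) (yes q) = ⊥-elim (¬p (Q⇒P q))

indicator-pos : ∀ {P : Set} (p : Dec P) → 1 ≤ indicator p → P
indicator-pos (yes p) _  = p
indicator-pos (no _)  ()

indicator-yes : ∀ {P : Set} (p : Dec P) → P → 1 ≤ indicator p
indicator-yes (yes _) _ = s≤s z≤n
indicator-yes (no ¬p) p = ⊥-elim (¬p p)

-- m + 2 vertices, so that each end vertex has a neighbour besides its loop.
path : ℕ → Graph
path m = graph (suc (suc m)) (λ i j → indicator (pathEdge? (suc (suc m)) (toℕ i) (toℕ j)))
                             (λ i j → indicator-cong PathEdge-sym PathEdge-sym _ _)

module _ (m : ℕ) where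
  private
    N = suc (suc m)

  path-edge : ∀ {i j} → 1 ≤ mult (path m) i j → PathEdge N (toℕ i) (toℕ j)
  path-edge {i} {j} = indicator-pos (pathEdge? N (toℕ i) (toℕ j))

  edge-path : ∀ {i j} → PathEdge N (toℕ i) (toℕ j) → 1 ≤ mult (path m) i j
  edge-path {i} {j} = indicator-yes (pathEdge? N (toℕ i) (toℕ j))

  path-supported : AllSupported (path m)
  path-supported i = supported (toℕ i) refl (toℕ<n i)
    where
      vertex : ∀ x → x < N → Σ (Fin N) λ b → toℕ b ≡ x
      vertex x x<N = fromℕ< x<N , toℕ-fromℕ< x<N

      ≢-by-toℕ : ∀ {b c : Fin N} {x y} → toℕ b ≡ x → toℕ c ≡ y → ¬ x ≡ y → ¬ b ≡ c
      ≢-by-toℕ b≡x c≡y x≢y refl = x≢y (trans (sym b≡x) c≡y)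

      supported : ∀ t → toℕ i ≡ t → t < N → Supported (path m) i
      supported zero i≡0 _ with vertex 1 (s≤s (s≤s z≤n))
      ... | b , b≡1 =
        inj₁ ( edge-path (inj₂ (inj₂ (refl , inj₁ i≡0)))
             , b , ≢-by-toℕ b≡1 i≡0 (λ ())
             , edge-path (inj₁ (trans b≡1 (cong suc (sym i≡0)))) )
      supported (suc s) i≡1+s 1+s<N with suc (suc s) ≟ N | vertex s (<⇒≤ 1+s<N)
      ... | yes 2+s≡N | b , b≡s =
        inj₁ ( edge-path (inj₂ (inj₂ (refl , inj₂ (trans (cong suc i≡1+s) 2+s≡N))))
             , b , ≢-by-toℕ b≡s i≡1+s (1+n≢n ∘ sym)
             , edge-path (inj₂ (inj₁ (trans i≡1+s (cong suc (sym b≡s))))) )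
      ... | no 2+s≢N | b , b≡s with vertex (suc (suc s)) (≤∧≢⇒< 1+s<N 2+s≢N)
      ...   | c , c≡2+s =
        inj₂ ( b , c
             , ≢-by-toℕ b≡s i≡1+s (1+n≢n ∘ sym)
             , ≢-by-toℕ c≡2+s i≡1+s 1+n≢n
             , ≢-by-toℕ b≡s c≡2+s (λ s≡2+s → <-irrefl s≡2+s (m<n+m s (s≤s z≤n)))
             , edge-path (inj₂ (inj₁ (trans i≡1+s (cong suc (sym b≡s)))))
             , edge-path (inj₁ (trans c≡2+s (cong suc (sym i≡1+s)))) )

  module _ {Y : Graph} (Y-supported : AllSupported Y) (e : Y ↪ path m) where
    private
      pos : Fin (n Y) → ℕ
      pos a = toℕ (vmap e a)

      Above Below : Fin (n Y) → Set
      Above a = ∃ λ b → pos b ≡ suc (pos a)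
      Below a = ∃ λ b → pos a ≡ suc (pos b)

      edge-image : ∀ {a b} → 1 ≤ mult Y a b → PathEdge N (pos a) (pos b)
      edge-image {a} {b} ab = path-edge (≤-trans ab (mult-≤ e a b))

      neighbour-image : ∀ {a b} → ¬ b ≡ a → 1 ≤ mult Y a b →
                        pos b ≡ suc (pos a) ⊎ pos a ≡ suc (pos b)
      neighbour-image b≢a ab with edge-image ab
      ... | inj₁ up                   = inj₁ up
      ... | inj₂ (inj₁ down)          = inj₂ down
      ... | inj₂ (inj₂ (same , _))    = ⊥-elim (b≢a (sym (injective e (toℕ-injective same))))

      loop-image : ∀ {a} → 1 ≤ mult Y a a → pos a ≡ 0 ⊎ suc (pos a) ≡ N
      loop-image aa with edge-image aa
      ... | inj₁ up                   = ⊥-elim (1+n≢n (sym up))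
      ... | inj₂ (inj₁ down)          = ⊥-elim (1+n≢n (sym down))
      ... | inj₂ (inj₂ (_ , end))     = end

      neighbours-in-path : ∀ a → (pos a ≡ 0 ⊎ Below a) × (suc (pos a) ≡ N ⊎ Above a)
      neighbours-in-path a with Y-supported a
      ... | inj₁ (aa , b , b≢a , ab) with loop-image aa | neighbour-image b≢a ab
      ...   | inj₁ first | inj₁ up   = inj₁ first , inj₂ (b , up)
      ...   | inj₁ first | inj₂ down = ⊥-elim (0≢1+n (trans (sym first) down))
      ...   | inj₂ last  | inj₁ up   = ⊥-elim (<-irrefl (trans up last) (toℕ<n (vmap e b)))
      ...   | inj₂ last  | inj₂ down = inj₂ (b , down) , inj₁ last
      neighbours-in-path a | inj₂ (b , c , b≢a , c≢a , b≢c , ab , ac)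
        with neighbour-image b≢a ab | neighbour-image c≢a ac
      ... | inj₁ b-up   | inj₁ c-up   = ⊥-elim (b≢c (injective e (toℕ-injective (trans b-up (sym c-up)))))
      ... | inj₁ b-up   | inj₂ c-down = inj₂ (c , c-down) , inj₂ (b , b-up)
      ... | inj₂ b-down | inj₁ c-up   = inj₂ (b , b-down) , inj₂ (c , c-up)
      ... | inj₂ b-down | inj₂ c-down =
        ⊥-elim (b≢c (injective e (toℕ-injective (suc-injective (trans (sym b-down) c-down)))))

      Reached : ℕ → Set
      Reached t = ∃ λ a → pos a ≡ t

      reach-0 : ∀ t → Reached t → Reached 0
      reach-0 zero    reached     = reached
      reach-0 (suc t) (a , a≡1+t) with proj₁ (neighbours-in-path a)
      ... | inj₁ a≡0        = ⊥-elim (0≢1+n (trans (sym a≡0) a≡1+t))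
      ... | inj₂ (b , a≡1+b) = reach-0 t (b , suc-injective (trans (sym a≡1+b) a≡1+t))

      reach-< : Reached 0 → ∀ t → t < N → Reached t
      reach-< reached zero    _     = reached
      reach-< reached (suc t) 1+t<N with reach-< reached t (<⇒≤ 1+t<N)
      ... | a , a≡t with proj₂ (neighbours-in-path a)
      ...   | inj₁ 1+a≡N         = ⊥-elim (<-irrefl (trans (cong suc (sym a≡t)) 1+a≡N) 1+t<N)
      ...   | inj₂ (b , b≡1+a)   = b , trans b≡1+a (cong suc a≡t)

    path-embedding-onto : Fin (n Y) → Onto (vmap e)
    path-embedding-onto y v with reach-< (reach-0 (pos y) (y , refl)) (toℕ v) (toℕ<n v)
    ... | a , a≡v = a , toℕ-injective a≡v

path-tight : ∀ m → Tight (path m)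
path-tight m = path-embedding-onto m

FiniteClass⇒bounded : ∀ B → FiniteClass B → ∃ λ N → ∀ G → _∈_ B G → n G ≤ N
FiniteClass⇒bounded B (L , listed) = maxSize L , λ G G∈B → listed⇒≤ {G} L (listed G G∈B)
  where
    maxSize : List Graph → ℕ
    maxSize = foldr (λ H r → n H ⊔ r) 0

    listed⇒≤ : ∀ {G} L → Any (G ≅_) L → n G ≤ maxSize L
    listed⇒≤ {G} (H ∷ L) (here G≅H)  = ≤-trans (≤-reflexive (≅⇒n≡ {G} {H} G≅H)) (m≤m⊔n (n H) (maxSize L))
    listed⇒≤ {G} (H ∷ L) (there any) = ≤-trans (listed⇒≤ {G} L any) (m≤n⊔m (n H) (maxSize L))

CompleteSystem-𝔖-infinite : ∀ B → CompleteSystem 𝔖 B → Infinite B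
CompleteSystem-𝔖-infinite B (_ , sound , complete) finite
  with FiniteClass⇒bounded B finite
... | N , bounded
  with Sup-Tight⇒member sound (complete (path N) (path-supported N)) (path-tight N) F.zero
... | Y , Y∈B , nY≡2+N = <-irrefl refl (≤-trans (≤-reflexive (sym nY≡2+N)) (m≤n⇒m≤1+n (bounded Y Y∈B)))

corollary2p1p1 : Σ GraphClass λ 𝔍 → Closed 𝔍 × (∀ B → ElementalBasis 𝔍 B → Infinite B)
corollary2p1p1 = 𝔖 , 𝔖-closed , λ B basis → CompleteSystem-𝔖-infinite B (proj₁ basis)
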